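{- The class of finite labeled switchboards is a Fraïssé class (it has the hereditary property, the amalgamation property and the joint embedding property).
   Context: For a set $M$, $[M]^2$ is the set of 2-element subsets of $M$. A switchboard is a set $M$ with a strict partial order $<$ on $[M]^2$ such that for distinct $x,y,z\in M$, $\{x,y\}$ and $\{x,z\}$ are incomparable. A labeled switchboard is $(M,<,\uparrow,\downarrow)$ where $(M,<)$ is a switchboard, $\uparrow,\downarrow$ are binary relations between $M$ and $[M]^2$, and: (Trichotomy) for every $a\in M$, $\{b,c\}\in[M]^2$ exactly one of $a\uparrow\{b,c\}$, $a\in\{b,c\}$, $a\downarrow\{b,c\}$ holds; (Upward) $a\uparrow\{b,c\}<\{b',c'\}$ implies $a\uparrow\{b',c'\}$; (Downward) $a\downarrow\{b,c\}>\{b',c'\}$ implies $a\downarrow\{b',c'\}$. Officially these are structures in the relational language $L^+$ with a 4-ary relation symbol $<(x,y,z,w)$ (meaning $x\ne y\wedge z\ne w\wedge\{x,y\}<\{z,w\}$) and 3-ary relation symbols $\uparrow(x,y,z)$, $\downarrow(x,y,z)$ (meaning $y\neq z$ and $x\uparrow\{y,z\}$, resp. $x\downarrow\{y,z\}$). -}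

module Defs where

open import Data.Nat using (ℕ)
open import Data.Fin using (Fin)
open import Data.Bool using (Bool; true; false)
open import Data.Product using (Σ; _×_; ∃; ∃-syntax)
open import Data.Sum using (_⊎_)
open import Data.Empty using (⊥)
open import Relation.Nullary using (¬_)
open import Relation.Binary.PropositionalEquality using (_≡_; _≢_)
open import Function.Definitions using (Injective)

-- A finite L⁺-structure: universe Fin n, a 4-ary relation lt (the symbol <),
-- and 3-ary relations up (↑) and down (↓), given as decidable (Bool-valued)
-- relations, as usual for finite structures.
record L⁺Str : Set where
  constructor mkStr
  field
    size : ℕ
    lt   : Fin size → Fin size → Fin size → Fin size → Bool
    up   : Fin size → Fin size → Fin size → Bool
    down : Fin size → Fin size → Fin size → Bool

ExactlyOne : Set → Set → Set → Set
ExactlyOne P Q R = (P ⊎ Q ⊎ R) × (P → ¬ Q) × (P → ¬ R) × (Q → ¬ R)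

record IsLabeledSwitchboard (S : L⁺Str) : Set where
  open L⁺Str S
  _<₂_ : Fin size → Fin size → Fin size → Fin size → Set
  _<₂_ x y z w = lt x y z w ≡ true
  _↑_ : Fin size → Fin size → Fin size → Set
  _↑_ a b c = up a b c ≡ true
  _↓_ : Fin size → Fin size → Fin size → Set
  _↓_ a b c = down a b c ≡ true
  field
    -- lt (x,y,z,w) means x ≠ y, z ≠ w and {x,y} < {z,w}:
    -- it only holds for genuine pairs and depends only on the sets {x,y},{z,w}
    lt-distinct₁ : ∀ x y z w → _<₂_ x y z w → x ≢ y
    lt-distinct₂ : ∀ x y z w → _<₂_ x y z w → z ≢ w
    lt-sym₁      : ∀ x y z w → _<₂_ x y z w → _<₂_ y x z w
    lt-sym₂      : ∀ x y z w → _<₂_ x y z w → _<₂_ x y w z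
    lt-irrefl    : ∀ x y → ¬ _<₂_ x y x y
    lt-trans     : ∀ x y z w u v → _<₂_ x y z w → _<₂_ z w u v → _<₂_ x y u v
    incomparable : ∀ x y z → x ≢ y → x ≢ z → y ≢ z → ¬ _<₂_ x y x z
    -- ↑(x,y,z), ↓(x,y,z) mean y ≠ z and x ↑ {y,z} (resp. x ↓ {y,z})
    up-distinct   : ∀ a b c → _↑_ a b c → b ≢ c
    up-sym        : ∀ a b c → _↑_ a b c → _↑_ a c b
    down-distinct : ∀ a b c → _↓_ a b c → b ≢ c
    down-sym      : ∀ a b c → _↓_ a b c → _↓_ a c b
    trichotomy : ∀ a b c → b ≢ c →
      ExactlyOne (_↑_ a b c) (a ≡ b ⊎ a ≡ c) (_↓_ a b c)
    upward   : ∀ a b c b' c' → _↑_ a b c → _<₂_ b c b' c' → _↑_ a b' c'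
    downward : ∀ a b c b' c' → _↓_ a b c → _<₂_ b' c' b c → _↓_ a b' c'

record Embedding (A B : L⁺Str) : Set where
  private
    module A = L⁺Str A
    module B = L⁺Str B
  field
    map       : Fin A.size → Fin B.size
    injective : Injective _≡_ _≡_ map
    pres-lt   : ∀ x y z w → B.lt (map x) (map y) (map z) (map w) ≡ A.lt x y z w
    pres-up   : ∀ x y z → B.up (map x) (map y) (map z) ≡ A.up x y z
    pres-down : ∀ x y z → B.down (map x) (map y) (map z) ≡ A.down x y z

open Embedding public

K : L⁺Str → Set
K = IsLabeledSwitchboard

HereditaryProperty : (L⁺Str → Set) → Set
HereditaryProperty C = ∀ (A B : L⁺Str) → C B → Embedding A B → C A

JointEmbeddingProperty : (L⁺Str → Set) → Set
JointEmbeddingProperty C = ∀ (A B : L⁺Str) → C A → C B →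
  Σ L⁺Str λ D → C D × Embedding A D × Embedding B D

AmalgamationProperty : (L⁺Str → Set) → Set
AmalgamationProperty C = ∀ (A B₁ B₂ : L⁺Str) → C A → C B₁ → C B₂ →
  (f₁ : Embedding A B₁) (f₂ : Embedding A B₂) →
  Σ L⁺Str λ D → C D × Σ (Embedding B₁ D) λ g₁ → Σ (Embedding B₂ D) λ g₂ →
    ∀ a → map g₁ (map f₁ a) ≡ map g₂ (map f₂ a)

IsFraisseClass : (L⁺Str → Set) → Set
IsFraisseClass C = HereditaryProperty C × AmalgamationProperty C × JointEmbeddingProperty C

{-# OPTIONS --safe #-}
-- All axioms are universal, so substructures inherit them.  To amalgamate B₁ and B₂ over A,
-- glue their universes along A.  As the two orders on pairs agree on A, the transitive closure
-- of their union needs chains of at most two steps, and it restricts to the order of each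
-- factor.  Declare x ↓ {y,z} when x ∉ {y,z} and some {u,v} ≥ {y,z} has x ↓ {u,v} in a factor
-- or x ∈ {u,v}, and x ↑ {y,z} otherwise; Trichotomy and Upward hold by construction.  What
-- needs proof is that an x ↑ {y,z} of a factor is never overridden: by Upward it propagates
-- along every chain above {y,z}, because with only two factors it can always be carried into
-- a factor containing the next pair.  Applied to x ↑ {u,v} for {x,c} < {u,v}, which holds in
-- every labeled switchboard, this yields Downward and incomparability of the amalgam.  Joint
-- embedding is amalgamation over the empty structure.

module Submission where

open import Defs
open import Data.Nat using (ℕ; _+_)
open import Data.Fin using (Fin; splitAt; _↑ˡ_; _↑ʳ_; _≟_)
open import Data.Fin.Properties using (any?; ↑ˡ-injective; ↑ʳ-injective; splitAt-↑ˡ; splitAt-↑ʳ)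
open import Data.Bool using (Bool; true)
open import Data.Bool.Properties using (⇔→≡) renaming (_≟_ to _≟ᵇ_)
open import Data.Product using (Σ; _×_; _,_; proj₁; proj₂; ∃)
open import Data.Product.Properties using (≡-dec)
open import Data.Sum using (_⊎_; inj₁; inj₂; [_,_]′)
import Data.Sum as Sum
open import Data.Empty using (⊥-elim)
open import Function using (_∘_; id)
open import Function.Bundles using (_⇔_; mk⇔; Equivalence)
open import Function.Definitions using (Injective)
open import Function.Construct.Identity using (⇔-id)
open import Function.Construct.Composition using (_⇔-∘_)
open import Relation.Nullary using (¬_; Dec; yes; no; does)
open import Relation.Nullary.Decidable using (_×-dec_; _⊎-dec_; ¬?; map′; dec-true)
open import Relation.Binary.PropositionalEquality using (_≡_; _≢_; refl; sym; trans; cong)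

open Equivalence using (to; from)

witness : {A : Set} (a? : Dec A) → does a? ≡ true → A
witness (yes a) _ = a

does≡ : {A : Set} {b : Bool} (a? : Dec A) → A ⇔ (b ≡ true) → does a? ≡ b
does≡ a? A⇔b = ⇔→≡ (A⇔b ⇔-∘ mk⇔ (witness a?) (dec-true a?))

ExactlyOne-map : {P Q R P′ Q′ R′ : Set} → P ⇔ P′ → Q ⇔ Q′ → R ⇔ R′ →
                 ExactlyOne P Q R → ExactlyOne P′ Q′ R′
ExactlyOne-map P⇔ Q⇔ R⇔ (one , p≠q , p≠r , q≠r) =
  Sum.map (to P⇔) (Sum.map (to Q⇔) (to R⇔)) one ,
  (λ p q → p≠q (from P⇔ p) (from Q⇔ q)) ,
  (λ p r → p≠r (from P⇔ p) (from R⇔ r)) ,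
  (λ q r → q≠r (from Q⇔ q) (from R⇔ r))

ExactlyOne-reflects : {P Q R P′ Q′ R′ : Set} → (P → P′) → (Q → Q′) → (R → R′) →
                      ExactlyOne P Q R → ExactlyOne P′ Q′ R′ → (P′ → P) × (R′ → R)
ExactlyOne-reflects P⇒ Q⇒ R⇒ (one , _) (_ , p′≠q′ , p′≠r′ , q′≠r′) =
  (λ p′ → [ id , [ ⊥-elim ∘ p′≠q′ p′ ∘ Q⇒ , ⊥-elim ∘ p′≠r′ p′ ∘ R⇒ ]′ ]′ one) ,
  (λ r′ → [ (λ p → ⊥-elim (p′≠r′ (P⇒ p) r′)) , [ (λ q → ⊥-elim (q′≠r′ (Q⇒ q) r′)) , id ]′ ]′ one)

_∈ᵖ_ : {A : Set} → A → A × A → Set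
x ∈ᵖ (u , v) = x ≡ u ⊎ x ≡ v

hereditary : HereditaryProperty K
hereditary A B KB e = record
  { lt-distinct₁  = λ x y z w l → B.lt-distinct₁ _ _ _ _ (lt→ l) ∘ cong m
  ; lt-distinct₂  = λ x y z w l → B.lt-distinct₂ _ _ _ _ (lt→ l) ∘ cong m
  ; lt-sym₁       = λ x y z w l → lt← (B.lt-sym₁ _ _ _ _ (lt→ l))
  ; lt-sym₂       = λ x y z w l → lt← (B.lt-sym₂ _ _ _ _ (lt→ l))
  ; lt-irrefl     = λ x y l → B.lt-irrefl _ _ (lt→ l)
  ; lt-trans      = λ x y z w u v l l′ → lt← (B.lt-trans _ _ _ _ _ _ (lt→ l) (lt→ l′))
  ; incomparable  = λ x y z x≢y x≢z y≢z l →
      B.incomparable _ _ _ (x≢y ∘ injective e) (x≢z ∘ injective e) (y≢z ∘ injective e) (lt→ l)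
  ; up-distinct   = λ a b c u → B.up-distinct _ _ _ (up→ u) ∘ cong m
  ; up-sym        = λ a b c u → up← (B.up-sym _ _ _ (up→ u))
  ; down-distinct = λ a b c d → B.down-distinct _ _ _ (down→ d) ∘ cong m
  ; down-sym      = λ a b c d → down← (B.down-sym _ _ _ (down→ d))
  ; trichotomy    = λ a b c b≢c →
      ExactlyOne-map (mk⇔ up← up→) (mk⇔ (Sum.map (injective e) (injective e)) (Sum.map (cong m) (cong m)))
                     (mk⇔ down← down→) (B.trichotomy _ _ _ (b≢c ∘ injective e))
  ; upward        = λ a b c b′ c′ u l → up← (B.upward _ _ _ _ _ (up→ u) (lt→ l))
  ; downward      = λ a b c b′ c′ d l → down← (B.downward _ _ _ _ _ (down→ d) (lt→ l))
  }
  where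
  module A = L⁺Str A
  module B where
    open L⁺Str B public
    open IsLabeledSwitchboard KB public

  m : Fin A.size → Fin B.size
  m = map e

  lt→ : ∀ {x y z w} → A.lt x y z w ≡ true → B.lt (m x) (m y) (m z) (m w) ≡ true
  lt→ = trans (pres-lt e _ _ _ _)
  lt← : ∀ {x y z w} → B.lt (m x) (m y) (m z) (m w) ≡ true → A.lt x y z w ≡ true
  lt← = trans (sym (pres-lt e _ _ _ _))
  up→ : ∀ {x y z} → A.up x y z ≡ true → B.up (m x) (m y) (m z) ≡ true
  up→ = trans (pres-up e _ _ _)
  up← : ∀ {x y z} → B.up (m x) (m y) (m z) ≡ true → A.up x y z ≡ true
  up← = trans (sym (pres-up e _ _ _))
  down→ : ∀ {x y z} → A.down x y z ≡ true → B.down (m x) (m y) (m z) ≡ true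
  down→ = trans (pres-down e _ _ _)
  down← : ∀ {x y z} → B.down (m x) (m y) (m z) ≡ true → A.down x y z ≡ true
  down← = trans (sym (pres-down e _ _ _))

module LabeledSwitchboard {S : L⁺Str} (KS : K S) where
  open L⁺Str S
  open IsLabeledSwitchboard KS

  up⇒∉ : ∀ {a b c} → up a b c ≡ true → ¬ a ∈ᵖ (b , c)
  up⇒∉ {a} {b} {c} h = let (_ , ↑≠∈ , _ , _) = trichotomy a b c (up-distinct a b c h) in ↑≠∈ h

  down⇒∉ : ∀ {a b c} → down a b c ≡ true → ¬ a ∈ᵖ (b , c)
  down⇒∉ {a} {b} {c} h m = let (_ , _ , _ , ∈≠↓) = trichotomy a b c (down-distinct a b c h) in ∈≠↓ m h

  up⇒¬down : ∀ {a b c} → up a b c ≡ true → ¬ down a b c ≡ true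
  up⇒¬down {a} {b} {c} h = let (_ , _ , ↑≠↓ , _) = trichotomy a b c (up-distinct a b c h) in ↑≠↓ h

  ¬ac<av : ∀ a c v → ¬ lt a c a v ≡ true
  ¬ac<av a c v h with c ≟ v
  ... | yes refl = lt-irrefl a c h
  ... | no c≢v = incomparable a c v (lt-distinct₁ a c a v h) (lt-distinct₂ a c a v h) c≢v h

  -- The trichotomy for a and {u,v} leaves only ↑: a ∈ {u,v} contradicts incomparability,
  -- and a ↓ {u,v} would propagate down to a ↓ {a,c}.
  ac<uv⇒up : ∀ {a c u v} → lt a c u v ≡ true → up a u v ≡ true
  ac<uv⇒up {a} {c} {u} {v} h with trichotomy a u v (lt-distinct₂ a c u v h)
  ... | inj₁ a↑uv , _ = a↑uv
  ... | inj₂ (inj₁ (inj₁ refl)) , _ = ⊥-elim (¬ac<av a c v h)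
  ... | inj₂ (inj₁ (inj₂ refl)) , _ = ⊥-elim (¬ac<av a c u (lt-sym₂ a c u a h))
  ... | inj₂ (inj₂ a↓uv) , _ = ⊥-elim (down⇒∉ (downward a u v a c a↓uv h) (inj₁ refl))

Pair : ℕ → Set
Pair n = Fin n × Fin n

_≟ᵖ_ : ∀ {n} (p q : Pair n) → Dec (p ≡ q)
_≟ᵖ_ = ≡-dec _≟_ _≟_

_∈?_ : ∀ {n} (x : Fin n) p → Dec (x ∈ᵖ p)
x ∈? (u , v) = x ≟ u ⊎-dec x ≟ v

pair-any? : ∀ {n} {Q : Pair n → Set} → (∀ p → Dec (Q p)) → Dec (∃ Q)
pair-any? Q? = map′ (λ (u , v , q) → (u , v) , q) (λ ((u , v) , q) → u , v , q)
                    (any? λ u → any? λ v → Q? (u , v))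

module Pushforward {S : L⁺Str} (KS : K S) {n : ℕ}
                   (g : Fin (L⁺Str.size S) → Fin n) (g-inj : Injective _≡_ _≡_ g) where
  open L⁺Str S
  open IsLabeledSwitchboard KS
  open LabeledSwitchboard KS

  Image : Fin n → Set
  Image x = ∃ λ a → g a ≡ x

  Image² : Pair n → Set
  Image² (x , y) = Image x × Image y

  data Lt : Pair n → Pair n → Set where
    lt⁺ : ∀ {a b c d} → lt a b c d ≡ true → Lt (g a , g b) (g c , g d)

  data Up : Fin n → Pair n → Set where
    up⁺ : ∀ {a b c} → up a b c ≡ true → Up (g a) (g b , g c)

  data Down : Fin n → Pair n → Set where
    down⁺ : ∀ {a b c} → down a b c ≡ true → Down (g a) (g b , g c)

  Lt-image : ∀ {p q} → Lt p q → Image² p × Image² q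
  Lt-image (lt⁺ _) = ((_ , refl) , (_ , refl)) , ((_ , refl) , (_ , refl))

  Up-image : ∀ {x p} → Up x p → Image x × Image² p
  Up-image (up⁺ _) = (_ , refl) , (_ , refl) , (_ , refl)

  Down-image : ∀ {x p} → Down x p → Image x × Image² p
  Down-image (down⁺ _) = (_ , refl) , (_ , refl) , (_ , refl)

  Lt⁻ : ∀ {x y z w a b c d} → Lt (x , y) (z , w) →
        g a ≡ x → g b ≡ y → g c ≡ z → g d ≡ w → lt a b c d ≡ true
  Lt⁻ (lt⁺ h) ea eb ec ed with g-inj ea | g-inj eb | g-inj ec | g-inj ed
  ... | refl | refl | refl | refl = h

  Up⁻ : ∀ {x y z a b c} → Up x (y , z) → g a ≡ x → g b ≡ y → g c ≡ z → up a b c ≡ true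
  Up⁻ (up⁺ h) ea eb ec with g-inj ea | g-inj eb | g-inj ec
  ... | refl | refl | refl = h

  Down⁻ : ∀ {x y z a b c} → Down x (y , z) → g a ≡ x → g b ≡ y → g c ≡ z → down a b c ≡ true
  Down⁻ (down⁺ h) ea eb ec with g-inj ea | g-inj eb | g-inj ec
  ... | refl | refl | refl = h

  image? : ∀ x → Dec (Image x)
  image? x = any? λ a → g a ≟ x

  Lt? : ∀ p q → Dec (Lt p q)
  Lt? (x , y) (z , w) with image? x | image? y | image? z | image? w
  ... | yes (a , refl) | yes (b , refl) | yes (c , refl) | yes (d , refl) =
    map′ lt⁺ (λ l → Lt⁻ l refl refl refl refl) (lt a b c d ≟ᵇ true)
  ... | no ∄a | _ | _ | _ = no (∄a ∘ proj₁ ∘ proj₁ ∘ Lt-image)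
  ... | _ | no ∄b | _ | _ = no (∄b ∘ proj₂ ∘ proj₁ ∘ Lt-image)
  ... | _ | _ | no ∄c | _ = no (∄c ∘ proj₁ ∘ proj₂ ∘ Lt-image)
  ... | _ | _ | _ | no ∄d = no (∄d ∘ proj₂ ∘ proj₂ ∘ Lt-image)

  Down? : ∀ x p → Dec (Down x p)
  Down? x (y , z) with image? x | image? y | image? z
  ... | yes (a , refl) | yes (b , refl) | yes (c , refl) =
    map′ down⁺ (λ d → Down⁻ d refl refl refl) (down a b c ≟ᵇ true)
  ... | no ∄a | _ | _ = no (∄a ∘ proj₁ ∘ Down-image)
  ... | _ | no ∄b | _ = no (∄b ∘ proj₁ ∘ proj₂ ∘ Down-image)
  ... | _ | _ | no ∄c = no (∄c ∘ proj₂ ∘ proj₂ ∘ Down-image)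

  Lt-trans : ∀ {p q r} → Lt p q → Lt q r → Lt p r
  Lt-trans (lt⁺ h) l with Lt-image l
  ... | _ , (e , refl) , (f , refl) = lt⁺ (lt-trans _ _ _ _ e f h (Lt⁻ l refl refl refl refl))

  Lt-irrefl : ∀ {p} → ¬ Lt p p
  Lt-irrefl l with Lt-image l
  ... | ((a , refl) , (b , refl)) , _ = lt-irrefl a b (Lt⁻ l refl refl refl refl)

  Lt-distinctˡ : ∀ {x y q} → Lt (x , y) q → x ≢ y
  Lt-distinctˡ (lt⁺ h) e = lt-distinct₁ _ _ _ _ h (g-inj e)

  Lt-distinctʳ : ∀ {p z w} → Lt p (z , w) → z ≢ w
  Lt-distinctʳ (lt⁺ h) e = lt-distinct₂ _ _ _ _ h (g-inj e)

  Lt-swapˡ : ∀ {x y q} → Lt (x , y) q → Lt (y , x) q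
  Lt-swapˡ (lt⁺ h) = lt⁺ (lt-sym₁ _ _ _ _ h)

  Lt-swapʳ : ∀ {p z w} → Lt p (z , w) → Lt p (w , z)
  Lt-swapʳ (lt⁺ h) = lt⁺ (lt-sym₂ _ _ _ _ h)

  Up-upward : ∀ {x p q} → Up x p → Lt p q → Up x q
  Up-upward (up⁺ h) l with Lt-image l
  ... | _ , (e , refl) , (f , refl) = up⁺ (upward _ _ _ e f h (Lt⁻ l refl refl refl refl))

  Up⇒¬Down : ∀ {x p} → Up x p → ¬ Down x p
  Up⇒¬Down (up⁺ h) d = up⇒¬down h (Down⁻ d refl refl refl)

  Up⇒∉ : ∀ {x p} → Up x p → ¬ x ∈ᵖ p
  Up⇒∉ (up⁺ h) = up⇒∉ h ∘ Sum.map g-inj g-inj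

  Down-distinct : ∀ {x y z} → Down x (y , z) → y ≢ z
  Down-distinct (down⁺ h) e = down-distinct _ _ _ h (g-inj e)

  Down-swap : ∀ {x y z} → Down x (y , z) → Down x (z , y)
  Down-swap (down⁺ h) = down⁺ (down-sym _ _ _ h)

  Lt⇒Up : ∀ {x c r} → Lt (x , c) r → Up x r
  Lt⇒Up (lt⁺ h) = up⁺ (ac<uv⇒up h)

data Side : Set where
  ₁ ₂ : Side

-- The only use of there being exactly two factors.
same-or-all : {P : Side → Set} (s t : Side) → P s → P t → s ≡ t ⊎ (∀ u → P u)
same-or-all ₁ ₁ _ _ = inj₁ refl
same-or-all ₂ ₂ _ _ = inj₁ refl
same-or-all ₁ ₂ p₁ p₂ = inj₂ λ { ₁ → p₁ ; ₂ → p₂ }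
same-or-all ₂ ₁ p₂ p₁ = inj₂ λ { ₁ → p₁ ; ₂ → p₂ }

side-any? : {Q : Side → Set} → (∀ s → Dec (Q s)) → Dec (Σ Side Q)
side-any? Q? = map′ [ (₁ ,_) , (₂ ,_) ]′ (λ { (₁ , q) → inj₁ q ; (₂ , q) → inj₂ q }) (Q? ₁ ⊎-dec Q? ₂)

module OrderGluing {X : Set} (Dom : Side → X → Set) (R : Side → X → X → Set)
  (R-dom      : ∀ {s p q} → R s p q → Dom s p × Dom s q)
  (R-trans    : ∀ {s p q r} → R s p q → R s q r → R s p r)
  (R-irrefl   : ∀ {s p} → ¬ R s p p)
  (R-transfer : ∀ {s t p q} → R s p q → Dom t p → Dom t q → R t p q)
  where

  _⊏_ : X → X → Set
  p ⊏ q = Σ Side λ s → R s p q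

  -- Chains of length at most two already give the transitive closure of _⊏_.
  _<⁺_ : X → X → Set
  p <⁺ r = ∃ λ q → p ⊏ q × (q ≡ r ⊎ q ⊏ r)

  _≤⁺_ : X → X → Set
  p ≤⁺ r = p ≡ r ⊎ p <⁺ r

  chain₂ : ∀ {s t p q r} → R s p q → R t q r → R s p r ⊎ (∀ u → Dom u q)
  chain₂ {s} {t} {q = q} l l′
    with same-or-all {λ u → Dom u q} s t (proj₂ (R-dom l)) (proj₁ (R-dom l′))
  ... | inj₁ refl = inj₁ (R-trans l l′)
  ... | inj₂ q-everywhere = inj₂ q-everywhere

  chain₃ : ∀ {p q r w} → p ⊏ q → q ⊏ r → r ⊏ w → p <⁺ w
  chain₃ (s , l₁) (t , l₂) (u , l₃) with chain₂ l₁ l₂ | chain₂ l₂ l₃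
  ... | inj₁ l₁₂ | _ = _ , (s , l₁₂) , inj₂ (u , l₃)
  ... | inj₂ _ | inj₁ l₂₃ = _ , (s , l₁) , inj₂ (t , l₂₃)
  ... | inj₂ q-everywhere | inj₂ r-everywhere =
    _ , (s , R-trans l₁ (R-transfer l₂ (q-everywhere s) (r-everywhere s))) , inj₂ (u , l₃)

  <⁺-snoc : ∀ {p r w} → p <⁺ r → r ⊏ w → p <⁺ w
  <⁺-snoc (_ , st , inj₁ refl) st′ = _ , st , inj₂ st′
  <⁺-snoc (_ , st , inj₂ st₂) st′ = chain₃ st st₂ st′

  <⁺-trans : ∀ {p q r} → p <⁺ q → q <⁺ r → p <⁺ r
  <⁺-trans l (_ , st , inj₁ refl) = <⁺-snoc l st
  <⁺-trans l (_ , st , inj₂ st′) = <⁺-snoc (<⁺-snoc l st) st′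

  <⁺-restrict : ∀ {s p r} → p <⁺ r → Dom s p → Dom s r → R s p r
  <⁺-restrict (_ , (_ , l) , inj₁ refl) dp dr = R-transfer l dp dr
  <⁺-restrict {s} (_ , (_ , l) , inj₂ (_ , l′)) dp dr with chain₂ l l′
  ... | inj₁ l″ = R-transfer l″ dp dr
  ... | inj₂ q-everywhere = R-trans (R-transfer l dp (q-everywhere s)) (R-transfer l′ (q-everywhere s) dr)

  <⁺-irrefl : ∀ {p} → ¬ p <⁺ p
  <⁺-irrefl l@(_ , (_ , l₁) , _) = R-irrefl (<⁺-restrict l (proj₁ (R-dom l₁)) (proj₁ (R-dom l₁)))

  ≤⁺-dom : ∀ {s p r} → Dom s p → p ≤⁺ r → ∃ λ t → Dom t r
  ≤⁺-dom dp (inj₁ refl) = _ , dp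
  ≤⁺-dom _ (inj₂ (_ , (t , l) , inj₁ refl)) = t , proj₂ (R-dom l)
  ≤⁺-dom _ (inj₂ (_ , _ , inj₂ (t , l))) = t , proj₂ (R-dom l)

record SetAmalgam {k n₁ n₂ : ℕ} (f₁ : Fin k → Fin n₁) (f₂ : Fin k → Fin n₂) : Set where
  field
    size            : ℕ
    inl             : Fin n₁ → Fin size
    inr             : Fin n₂ → Fin size
    inl-injective   : Injective _≡_ _≡_ inl
    inr-injective   : Injective _≡_ _≡_ inr
    commute         : ∀ a → inl (f₁ a) ≡ inr (f₂ a)
    common-preimage : ∀ {b c} → inl b ≡ inr c → ∃ λ a → f₁ a ≡ b × f₂ a ≡ c

↑ˡ≢↑ʳ : ∀ {m n} (i : Fin m) (j : Fin n) → i ↑ˡ n ≢ m ↑ʳ j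
↑ˡ≢↑ʳ {m} {n} i j e with trans (sym (splitAt-↑ˡ m i n)) (trans (cong (splitAt m) e) (splitAt-↑ʳ m n j))
... | ()

-- Fin n₂ is placed after Fin n₁, except that f₂ a is sent to f₁ a; the slots n₁ ↑ʳ f₂ a stay unused.
setAmalgam : ∀ {k n₁ n₂} {f₁ : Fin k → Fin n₁} {f₂ : Fin k → Fin n₂} →
             Injective _≡_ _≡_ f₁ → Injective _≡_ _≡_ f₂ → SetAmalgam f₁ f₂
setAmalgam {k} {n₁} {n₂} {f₁} {f₂} f₁-inj f₂-inj = record
  { size            = n₁ + n₂
  ; inl             = inl
  ; inr             = λ c → inr-by c (image₂? c)
  ; inl-injective   = ↑ˡ-injective n₂ _ _
  ; inr-injective   = λ {c} {c′} → inr-by-injective (image₂? c) (image₂? c′)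
  ; commute         = λ a → sym (inr-by-image a (image₂? (f₂ a)))
  ; common-preimage = λ {_} {c} → common-preimage-by (image₂? c)
  }
  where
  inl : Fin n₁ → Fin (n₁ + n₂)
  inl b = b ↑ˡ n₂

  image₂? : ∀ c → Dec (∃ λ a → f₂ a ≡ c)
  image₂? c = any? λ a → f₂ a ≟ c

  inr-by : ∀ c → Dec (∃ λ a → f₂ a ≡ c) → Fin (n₁ + n₂)
  inr-by c (yes (a , _)) = inl (f₁ a)
  inr-by c (no _) = n₁ ↑ʳ c

  inr-by-injective : ∀ {c c′} d d′ → inr-by c d ≡ inr-by c′ d′ → c ≡ c′
  inr-by-injective (yes (a , refl)) (yes (a′ , refl)) e = cong f₂ (f₁-inj (↑ˡ-injective n₂ _ _ e))
  inr-by-injective (yes _) (no _) e = ⊥-elim (↑ˡ≢↑ʳ _ _ e)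
  inr-by-injective (no _) (yes _) e = ⊥-elim (↑ˡ≢↑ʳ _ _ (sym e))
  inr-by-injective (no _) (no _) e = ↑ʳ-injective n₁ _ _ e

  inr-by-image : ∀ a d → inr-by (f₂ a) d ≡ inl (f₁ a)
  inr-by-image a (yes (a′ , e)) = cong (inl ∘ f₁) (f₂-inj e)
  inr-by-image a (no ∄a) = ⊥-elim (∄a (a , refl))

  common-preimage-by : ∀ {b c} d → inl b ≡ inr-by c d → ∃ λ a → f₁ a ≡ b × f₂ a ≡ c
  common-preimage-by (yes (a , f₂a≡c)) e = a , sym (↑ˡ-injective n₂ _ _ e) , f₂a≡c
  common-preimage-by (no _) e = ⊥-elim (↑ˡ≢↑ʳ _ _ e)

module Overlap {A B B′ : L⁺Str} (KB : K B) (KB′ : K B′) (f : Embedding A B) (f′ : Embedding A B′)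
  {n : ℕ} {g : Fin (L⁺Str.size B) → Fin n} {g′ : Fin (L⁺Str.size B′) → Fin n}
  (g-inj : Injective _≡_ _≡_ g) (g′-inj : Injective _≡_ _≡_ g′)
  (meet : ∀ {b b′} → g b ≡ g′ b′ → ∃ λ a → map f a ≡ b × map f′ a ≡ b′)
  where
  module P  = Pushforward KB g g-inj
  module P′ = Pushforward KB′ g′ g′-inj

  Lt-cross : ∀ {p q} → P.Lt p q → P′.Image² p → P′.Image² q → P′.Lt p q
  Lt-cross l ((_ , refl) , (_ , refl)) ((_ , refl) , (_ , refl)) with P.Lt-image l
  ... | ((_ , ea) , (_ , eb)) , ((_ , ec) , (_ , ed)) with meet ea | meet eb | meet ec | meet ed
  ... | α , refl , refl | β , refl , refl | γ , refl , refl | δ , refl , refl =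
    P′.lt⁺ (trans (pres-lt f′ α β γ δ) (trans (sym (pres-lt f α β γ δ)) (P.Lt⁻ l ea eb ec ed)))

  Up-cross : ∀ {x p} → P.Up x p → P′.Image x → P′.Image² p → P′.Up x p
  Up-cross u (_ , refl) ((_ , refl) , (_ , refl)) with P.Up-image u
  ... | (_ , ea) , (_ , eb) , (_ , ec) with meet ea | meet eb | meet ec
  ... | α , refl , refl | β , refl , refl | γ , refl , refl =
    P′.up⁺ (trans (pres-up f′ α β γ) (trans (sym (pres-up f α β γ)) (P.Up⁻ u ea eb ec)))

module Amalgam {A B₁ B₂ : L⁺Str} (KB₁ : K B₁) (KB₂ : K B₂)
               (f₁ : Embedding A B₁) (f₂ : Embedding A B₂)
               (M : SetAmalgam (map f₁) (map f₂)) where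
  open SetAmalgam M

  B : Side → L⁺Str
  B ₁ = B₁
  B ₂ = B₂

  KB : ∀ s → K (B s)
  KB ₁ = KB₁
  KB ₂ = KB₂

  g : ∀ s → Fin (L⁺Str.size (B s)) → Fin size
  g ₁ = inl
  g ₂ = inr

  g-inj : ∀ s → Injective _≡_ _≡_ (g s)
  g-inj ₁ = inl-injective
  g-inj ₂ = inr-injective

  module P (s : Side) = Pushforward (KB s) (g s) (g-inj s)
  open P using (Image; Image²; Lt; Up; Down; lt⁺; up⁺; down⁺)

  common-preimageʳ : ∀ {c b} → inr c ≡ inl b → ∃ λ a → map f₂ a ≡ c × map f₁ a ≡ b
  common-preimageʳ e = let (a , f₁a≡b , f₂a≡c) = common-preimage (sym e) in a , f₂a≡c , f₁a≡b

  module O₁₂ = Overlap KB₁ KB₂ f₁ f₂ inl-injective inr-injective common-preimage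
  module O₂₁ = Overlap KB₂ KB₁ f₂ f₁ inr-injective inl-injective common-preimageʳ

  Lt-transfer : ∀ {s t p q} → Lt s p q → Image² t p → Image² t q → Lt t p q
  Lt-transfer {₁} {₁} l _ _ = l
  Lt-transfer {₂} {₂} l _ _ = l
  Lt-transfer {₁} {₂} = O₁₂.Lt-cross
  Lt-transfer {₂} {₁} = O₂₁.Lt-cross

  Up-transfer : ∀ {s t x p} → Up s x p → Image t x → Image² t p → Up t x p
  Up-transfer {₁} {₁} u _ _ = u
  Up-transfer {₂} {₂} u _ _ = u
  Up-transfer {₁} {₂} = O₁₂.Up-cross
  Up-transfer {₂} {₁} = O₂₁.Up-cross

  open OrderGluing Image² Lt (P.Lt-image _) (P.Lt-trans _) (P.Lt-irrefl _) Lt-transfer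

  DownOrIn : Fin size → Pair size → Set
  DownOrIn x r = (Σ Side λ s → Down s x r) ⊎ x ∈ᵖ r

  Lowered : Fin size → Pair size → Set
  Lowered x p = ∃ λ r → p ≤⁺ r × DownOrIn x r

  _↑ᴰ_ : Fin size → Pair size → Set
  x ↑ᴰ (y , z) = y ≢ z × ¬ Lowered x (y , z)

  _↓ᴰ_ : Fin size → Pair size → Set
  x ↓ᴰ p = ¬ x ∈ᵖ p × Lowered x p

  UpWherever : Fin size → Pair size → Set
  UpWherever x r = ∀ t → Image t x → Image² t r → Up t x r

  -- If t = s the step can be moved into s; otherwise x lies in both factors, hence in k.
  up-step : ∀ {s k x p r} → Up s x p → Lt k p r → UpWherever x r
  up-step {s} {k} {x} u l t xt rt with same-or-all {λ v → Image v x} s t (proj₁ (P.Up-image s u)) xt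
  ... | inj₁ refl = P.Up-upward s u (Lt-transfer l (proj₂ (P.Up-image s u)) rt)
  ... | inj₂ x-everywhere =
    Up-transfer (P.Up-upward k (Up-transfer u (x-everywhere k) (proj₁ (P.Lt-image k l))) l) xt rt

  Up⇒UpWherever : ∀ {s x p r} → Up s x p → p ≤⁺ r → UpWherever x r
  Up⇒UpWherever u (inj₁ refl) t xt rt = Up-transfer u xt rt
  Up⇒UpWherever u (inj₂ (_ , (_ , l) , inj₁ refl)) = up-step u l
  Up⇒UpWherever {s} u (inj₂ (_ , (_ , l) , inj₂ (_ , l′))) with chain₂ l l′
  ... | inj₁ l″ = up-step u l″
  ... | inj₂ q-everywhere = up-step (up-step u l s (proj₁ (P.Up-image s u)) (q-everywhere s)) l′

  UpWherever⇒¬DownOrIn : ∀ {k x r} → UpWherever x r → Image² k r → ¬ DownOrIn x r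
  UpWherever⇒¬DownOrIn x↑r _ (inj₁ (t , d)) =
    let (xt , rt) = P.Down-image t d in P.Up⇒¬Down t (x↑r t xt rt) d
  UpWherever⇒¬DownOrIn {k} x↑r (uk , vk) (inj₂ (inj₁ refl)) = P.Up⇒∉ k (x↑r k uk (uk , vk)) (inj₁ refl)
  UpWherever⇒¬DownOrIn {k} x↑r (uk , vk) (inj₂ (inj₂ refl)) = P.Up⇒∉ k (x↑r k vk (uk , vk)) (inj₂ refl)

  Up⇒¬Lowered : ∀ {s x p} → Up s x p → ¬ Lowered x p
  Up⇒¬Lowered {s} u (_ , p≤r , dr) =
    let (_ , rk) = ≤⁺-dom (proj₂ (P.Up-image s u)) p≤r
    in UpWherever⇒¬DownOrIn (Up⇒UpWherever u p≤r) rk dr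

  Lowered-downward : ∀ {x p q} → p <⁺ q → Lowered x q → Lowered x p
  Lowered-downward p<q (r , inj₁ refl , dr) = r , inj₂ p<q , dr
  Lowered-downward p<q (r , inj₂ q<r , dr) = r , inj₂ (<⁺-trans p<q q<r) , dr

  <⁺⇒¬Lowered : ∀ {x c q} → (x , c) <⁺ q → ¬ Lowered x q
  <⁺⇒¬Lowered (_ , (k , l) , inj₁ refl) = Up⇒¬Lowered (P.Lt⇒Up k l)
  <⁺⇒¬Lowered (_ , (k , l) , inj₂ st) = Up⇒¬Lowered (P.Lt⇒Up k l) ∘ Lowered-downward (_ , st , inj₁ refl)

  <⁺-distinctˡ : ∀ {x y r} → (x , y) <⁺ r → x ≢ y
  <⁺-distinctˡ (_ , (s , l) , _) = P.Lt-distinctˡ s l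

  <⁺-distinctʳ : ∀ {p z w} → p <⁺ (z , w) → z ≢ w
  <⁺-distinctʳ (_ , (s , l) , inj₁ refl) = P.Lt-distinctʳ s l
  <⁺-distinctʳ (_ , _ , inj₂ (s , l)) = P.Lt-distinctʳ s l

  <⁺-swapˡ : ∀ {x y r} → (x , y) <⁺ r → (y , x) <⁺ r
  <⁺-swapˡ (_ , (s , l) , rest) = _ , (s , P.Lt-swapˡ s l) , rest

  <⁺-swapʳ : ∀ {p z w} → p <⁺ (z , w) → p <⁺ (w , z)
  <⁺-swapʳ (_ , (s , l) , inj₁ refl) = _ , (s , P.Lt-swapʳ s l) , inj₁ refl
  <⁺-swapʳ (_ , st , inj₂ (s , l)) = _ , st , inj₂ (s , P.Lt-swapʳ s l)

  DownOrIn-swap : ∀ {x y z} → DownOrIn x (y , z) → DownOrIn x (z , y)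
  DownOrIn-swap (inj₁ (s , d)) = inj₁ (s , P.Down-swap s d)
  DownOrIn-swap (inj₂ x∈) = inj₂ (Sum.swap x∈)

  Lowered-swap : ∀ {x y z} → Lowered x (y , z) → Lowered x (z , y)
  Lowered-swap (_ , inj₁ refl , dr) = _ , inj₁ refl , DownOrIn-swap dr
  Lowered-swap (r , inj₂ l , dr) = r , inj₂ (<⁺-swapˡ l) , dr

  ∈⇒Lowered : ∀ {x p} → x ∈ᵖ p → Lowered x p
  ∈⇒Lowered x∈ = _ , inj₁ refl , inj₂ x∈

  Down⇒Lowered : ∀ {s x p} → Down s x p → Lowered x p
  Down⇒Lowered d = _ , inj₁ refl , inj₁ (_ , d)

  ↑ᴰ-swap : ∀ {x y z} → x ↑ᴰ (y , z) → x ↑ᴰ (z , y)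
  ↑ᴰ-swap (y≢z , ¬lowered) = y≢z ∘ sym , ¬lowered ∘ Lowered-swap

  ↓ᴰ-swap : ∀ {x y z} → x ↓ᴰ (y , z) → x ↓ᴰ (z , y)
  ↓ᴰ-swap (x∉ , lowered) = x∉ ∘ Sum.swap , Lowered-swap lowered

  ↓ᴰ-distinct : ∀ {x y z} → x ↓ᴰ (y , z) → y ≢ z
  ↓ᴰ-distinct (_ , _ , inj₁ refl , inj₁ (s , d)) = P.Down-distinct s d
  ↓ᴰ-distinct (x∉ , _ , inj₁ refl , inj₂ x∈) = ⊥-elim (x∉ x∈)
  ↓ᴰ-distinct (_ , _ , inj₂ l , _) = <⁺-distinctˡ l

  ↑ᴰ-upward : ∀ {x p q} → x ↑ᴰ p → p <⁺ q → x ↑ᴰ q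
  ↑ᴰ-upward {q = _ , _} (_ , ¬lowered) p<q = <⁺-distinctʳ p<q , ¬lowered ∘ Lowered-downward p<q

  ↓ᴰ-downward : ∀ {x p q} → x ↓ᴰ q → p <⁺ q → x ↓ᴰ p
  ↓ᴰ-downward (_ , lowered) p<q = x∉ p<q , Lowered-downward p<q lowered
    where
    x∉ : ∀ {p} → p <⁺ _ → ¬ _ ∈ᵖ p
    x∉ p<q (inj₁ refl) = <⁺⇒¬Lowered p<q lowered
    x∉ p<q (inj₂ refl) = <⁺⇒¬Lowered (<⁺-swapˡ p<q) lowered

  _⊏?_ : ∀ p q → Dec (p ⊏ q)
  p ⊏? q = side-any? λ s → P.Lt? s p q

  _<⁺?_ : ∀ p r → Dec (p <⁺ r)
  p <⁺? r = pair-any? λ q → p ⊏? q ×-dec (q ≟ᵖ r ⊎-dec q ⊏? r)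

  Lowered? : ∀ x p → Dec (Lowered x p)
  Lowered? x p =
    pair-any? λ r → (p ≟ᵖ r ⊎-dec p <⁺? r) ×-dec (side-any? (λ s → P.Down? s x r) ⊎-dec x ∈? r)

  _↑ᴰ?_ : ∀ x p → Dec (x ↑ᴰ p)
  x ↑ᴰ? (y , z) = ¬? (y ≟ z) ×-dec ¬? (Lowered? x (y , z))

  _↓ᴰ?_ : ∀ x p → Dec (x ↓ᴰ p)
  x ↓ᴰ? p = ¬? (x ∈? p) ×-dec Lowered? x p

  trichotomyᴰ : ∀ x y z → y ≢ z → ExactlyOne (x ↑ᴰ (y , z)) (x ∈ᵖ (y , z)) (x ↓ᴰ (y , z))
  trichotomyᴰ x y z y≢z =
    one , (λ (_ , ¬lowered) → ¬lowered ∘ ∈⇒Lowered) , (λ (_ , ¬lowered) (_ , lowered) → ¬lowered lowered) , λ x∈ (x∉ , _) → x∉ x∈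
    where
    one : x ↑ᴰ (y , z) ⊎ x ∈ᵖ (y , z) ⊎ x ↓ᴰ (y , z)
    one with Lowered? x (y , z) | x ∈? (y , z)
    ... | no ¬lowered | _ = inj₁ (y≢z , ¬lowered)
    ... | yes _ | yes x∈ = inj₂ (inj₁ x∈)
    ... | yes lowered | no x∉ = inj₂ (inj₂ (x∉ , lowered))

  glued : L⁺Str
  glued = mkStr size (λ x y z w → does ((x , y) <⁺? (z , w)))
                     (λ x y z → does (x ↑ᴰ? (y , z)))
                     (λ x y z → does (x ↓ᴰ? (y , z)))

  glued-K : K glued
  glued-K = record
    { lt-distinct₁  = λ x y z w → <⁺-distinctˡ ∘ <⁺⁻
    ; lt-distinct₂  = λ x y z w → <⁺-distinctʳ ∘ <⁺⁻
    ; lt-sym₁       = λ x y z w → <⁺⁺ ∘ <⁺-swapˡ ∘ <⁺⁻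
    ; lt-sym₂       = λ x y z w → <⁺⁺ ∘ <⁺-swapʳ ∘ <⁺⁻
    ; lt-irrefl     = λ x y → <⁺-irrefl ∘ <⁺⁻
    ; lt-trans      = λ x y z w u v l l′ → <⁺⁺ (<⁺-trans (<⁺⁻ l) (<⁺⁻ l′))
    ; incomparable  = λ x y z _ _ _ l → <⁺⇒¬Lowered (<⁺⁻ l) (∈⇒Lowered (inj₁ refl))
    ; up-distinct   = λ a b c → proj₁ ∘ ↑ᴰ⁻
    ; up-sym        = λ a b c → ↑ᴰ⁺ ∘ ↑ᴰ-swap ∘ ↑ᴰ⁻
    ; down-distinct = λ a b c → ↓ᴰ-distinct ∘ ↓ᴰ⁻
    ; down-sym      = λ a b c → ↓ᴰ⁺ ∘ ↓ᴰ-swap ∘ ↓ᴰ⁻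
    ; trichotomy    = λ a b c b≢c →
        ExactlyOne-map (mk⇔ ↑ᴰ⁺ ↑ᴰ⁻) (⇔-id _) (mk⇔ ↓ᴰ⁺ ↓ᴰ⁻) (trichotomyᴰ a b c b≢c)
    ; upward        = λ a b c b′ c′ u l → ↑ᴰ⁺ (↑ᴰ-upward (↑ᴰ⁻ u) (<⁺⁻ l))
    ; downward      = λ a b c b′ c′ d l → ↓ᴰ⁺ (↓ᴰ-downward (↓ᴰ⁻ d) (<⁺⁻ l))
    }
    where
    <⁺⁻ : ∀ {p q} → does (p <⁺? q) ≡ true → p <⁺ q
    <⁺⁻ = witness (_ <⁺? _)
    <⁺⁺ : ∀ {p q} → p <⁺ q → does (p <⁺? q) ≡ true
    <⁺⁺ = dec-true (_ <⁺? _)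
    ↑ᴰ⁻ : ∀ {x p} → does (x ↑ᴰ? p) ≡ true → x ↑ᴰ p
    ↑ᴰ⁻ = witness (_ ↑ᴰ? _)
    ↑ᴰ⁺ : ∀ {x p} → x ↑ᴰ p → does (x ↑ᴰ? p) ≡ true
    ↑ᴰ⁺ = dec-true (_ ↑ᴰ? _)
    ↓ᴰ⁻ : ∀ {x p} → does (x ↓ᴰ? p) ≡ true → x ↓ᴰ p
    ↓ᴰ⁻ = witness (_ ↓ᴰ? _)
    ↓ᴰ⁺ : ∀ {x p} → x ↓ᴰ p → does (x ↓ᴰ? p) ≡ true
    ↓ᴰ⁺ = dec-true (_ ↓ᴰ? _)

  module _ (s : Side) where
    open L⁺Str (B s)
    open IsLabeledSwitchboard (KB s)

    in-image : ∀ {a} → Image s (g s a)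
    in-image = _ , refl

    <⁺⇔lt : ∀ {a b c d} → (g s a , g s b) <⁺ (g s c , g s d) ⇔ (lt a b c d ≡ true)
    <⁺⇔lt = mk⇔ (λ l → P.Lt⁻ s (<⁺-restrict l (in-image , in-image) (in-image , in-image)) refl refl refl refl)
                (λ h → _ , (s , lt⁺ h) , inj₁ refl)

    up⇒↑ᴰ : ∀ {a b c} → up a b c ≡ true → g s a ↑ᴰ (g s b , g s c)
    up⇒↑ᴰ {a} {b} {c} h = up-distinct a b c h ∘ g-inj s , Up⇒¬Lowered (up⁺ h)

    down⇒↓ᴰ : ∀ {a b c} → down a b c ≡ true → g s a ↓ᴰ (g s b , g s c)
    down⇒↓ᴰ h = LabeledSwitchboard.down⇒∉ (KB s) h ∘ Sum.map (g-inj s) (g-inj s) , Down⇒Lowered (down⁺ h)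

    labels-reflect : ∀ {a b c} → b ≢ c →
      (g s a ↑ᴰ (g s b , g s c) → up a b c ≡ true) × (g s a ↓ᴰ (g s b , g s c) → down a b c ≡ true)
    labels-reflect {a} {b} {c} b≢c =
      ExactlyOne-reflects up⇒↑ᴰ (Sum.map (cong (g s)) (cong (g s))) down⇒↓ᴰ
        (trichotomy a b c b≢c) (trichotomyᴰ _ _ _ (b≢c ∘ g-inj s))

    ↑ᴰ⇔up : ∀ {a b c} → g s a ↑ᴰ (g s b , g s c) ⇔ (up a b c ≡ true)
    ↑ᴰ⇔up = mk⇔ (λ u → proj₁ (labels-reflect (proj₁ u ∘ cong (g s))) u) up⇒↑ᴰ

    ↓ᴰ⇔down : ∀ {a b c} → g s a ↓ᴰ (g s b , g s c) ⇔ (down a b c ≡ true)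
    ↓ᴰ⇔down = mk⇔ (λ d → proj₂ (labels-reflect (↓ᴰ-distinct d ∘ cong (g s))) d) down⇒↓ᴰ

    embedding : Embedding (B s) glued
    embedding = record
      { map       = g s
      ; injective = g-inj s
      ; pres-lt   = λ _ _ _ _ → does≡ (_ <⁺? _) <⁺⇔lt
      ; pres-up   = λ _ _ _ → does≡ (_ ↑ᴰ? _) ↑ᴰ⇔up
      ; pres-down = λ _ _ _ → does≡ (_ ↓ᴰ? _) ↓ᴰ⇔down
      }

  embeddings-commute : ∀ a → map (embedding ₁) (map f₁ a) ≡ map (embedding ₂) (map f₂ a)
  embeddings-commute = commute

amalgamation : AmalgamationProperty K
amalgamation A B₁ B₂ _ KB₁ KB₂ f₁ f₂ = glued , glued-K , embedding ₁ , embedding ₂ , embeddings-commute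
  where open Amalgam KB₁ KB₂ f₁ f₂ (setAmalgam (injective f₁) (injective f₂))

empty : L⁺Str
empty = mkStr 0 (λ ()) (λ ()) (λ ())

empty-K : K empty
empty-K = record
  { lt-distinct₁ = λ () ; lt-distinct₂ = λ () ; lt-sym₁ = λ () ; lt-sym₂ = λ ()
  ; lt-irrefl = λ () ; lt-trans = λ () ; incomparable = λ ()
  ; up-distinct = λ () ; up-sym = λ () ; down-distinct = λ () ; down-sym = λ ()
  ; trichotomy = λ () ; upward = λ () ; downward = λ ()
  }

empty-embedding : ∀ X → Embedding empty X
empty-embedding X = record
  { map = λ () ; injective = λ { {()} } ; pres-lt = λ () ; pres-up = λ () ; pres-down = λ () }

joint-embedding : JointEmbeddingProperty K
joint-embedding X Y KX KY =
  let (D , KD , e₁ , e₂ , _) = amalgamation empty X Y empty-K KX KY (empty-embedding X) (empty-embedding Y)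
  in D , KD , e₁ , e₂

proposition4p17 : IsFraisseClass K
proposition4p17 = hereditary , amalgamation , joint-embedding
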